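{- Let $n \geq 5$, $j \in [n]$, and let $(u,v)$ be an edge of $S_n^{2:j}$ with $u = x_1x_2\cdots x_{n-1}j$. If $T \subseteq [n]\setminus\{x_1,x_2,j\}$ (possibly empty), then there exists a cycle $C$ in $S_n^2$ with $$V(C) = \Big(\bigcup_{t \in T} V(S_n^{2:t})\Big) \cup V(S_n^{2:x_1}) \cup V(S_n^{2:x_2}) \cup \{u,v\}$$ and $(u,v) \in E(C)$.
   Context: For $n \geq 3$, the split-star network $S_n^2$ is the graph whose vertex set is the set of all permutations of $[n]$, written as strings $x_1x_2\cdots x_n$. Two distinct vertices $u = x_1\cdots x_n$ and $v = y_1\cdots y_n$ are adjacent iff one of the following holds: (i) $y_1 = x_2$, $y_2 = x_1$, $y_j = x_j$ for all $j \in [3,n]$; (ii) for some $i \in [3,n]$: $y_1 = x_2$, $y_2 = x_i$, $y_i = x_1$, $y_j = x_j$ for $j \in [3,n]\setminus\{i\}$; (iii) for some $i \in [3,n]$: $y_1 = x_i$, $y_2 = x_1$, $y_i = x_2$, $y_j = x_j$ for $j \in [3,n]\setminus\{i\}$. For $i \in [n]$, $S_n^{2:i}$ is the subgraph of $S_n^2$ induced by all vertices whose last symbol is $i$ (i.e. $x_n = i$). -}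

module Defs where

open import Data.Nat using (ℕ; suc; _≤_)
open import Data.Fin using (Fin; zero; suc; fromℕ)
open import Data.Fin.Subset using (Subset) renaming (_∈_ to _∈ˢ_)
open import Data.Vec using (Vec; lookup; toList; _[_]≔_)
open import Data.List using (List; []; _∷_; _++_; [_]; length)
open import Data.List.Membership.Propositional using (_∈_)
open import Data.List.Relation.Unary.All using (All)
open import Data.List.Relation.Unary.Unique.Propositional using (Unique)
open import Data.List.Relation.Unary.Linked using (Linked)
open import Data.Product using (Σ; ∃; ∃₂; _×_)
open import Data.Sum using (_⊎_)
open import Relation.Binary.PropositionalEquality using (_≡_; _≢_)
open import Function.Bundles using (_⇔_)

-- Throughout, n = suc (suc m) (so n ≥ 2), symbols [n] are represented by
-- Fin n and positions 1..n by Fin n (position p ↦ index p-1).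
-- Position 1 = zero, position 2 = suc zero, position i ∈ [3,n] = suc (suc k), k : Fin m.

Str : ℕ → Set
Str m = Vec (Fin (suc (suc m))) (suc (suc m))

IsPerm : ∀ {m} → Str m → Set
IsPerm u = Unique (toList u)

lastSym : ∀ {m} → Str m → Fin (suc (suc m))
lastSym {m} u = lookup u (fromℕ (suc m))

sym1 sym2 : ∀ {m} → Str m → Fin (suc (suc m))
sym1 u = lookup u zero
sym2 u = lookup u (suc zero)

move-i : ∀ {m} → Str m → Str m
move-i u = (u [ zero ]≔ sym2 u) [ suc zero ]≔ sym1 u

-- (ii) with i = k+3: y1 = x2, y2 = xi, yi = x1, rest unchanged
move-ii : ∀ {m} → Fin m → Str m → Str m
move-ii k u =
  ((u [ zero ]≔ sym2 u) [ suc zero ]≔ lookup u (suc (suc k))) [ suc (suc k) ]≔ sym1 u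

-- (iii) with i = k+3: y1 = xi, y2 = x1, yi = x2, rest unchanged
move-iii : ∀ {m} → Fin m → Str m → Str m
move-iii k u =
  ((u [ zero ]≔ lookup u (suc (suc k))) [ suc zero ]≔ sym1 u) [ suc (suc k) ]≔ sym2 u

Adj : ∀ {m} → Str m → Str m → Set
Adj {m} u v =
  u ≢ v × (v ≡ move-i u ⊎ (∃ λ (k : Fin m) → v ≡ move-ii k u)
                      ⊎ (∃ λ (k : Fin m) → v ≡ move-iii k u))

record Cycle (m : ℕ) : Set where
  constructor cycle
  field
    c      : Str m
    cs     : List (Str m)
    len≥3  : 3 ≤ length (c ∷ cs)
    perms  : All IsPerm (c ∷ cs)
    unique : Unique (c ∷ cs)
    closed : Linked Adj (c ∷ cs ++ [ c ])

open Cycle public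

_∈V_ : ∀ {m} → Str m → Cycle m → Set
w ∈V C = w ∈ (c C ∷ cs C)

_∈E_ : ∀ {m} → (Str m × Str m) → Cycle m → Set
(a Data.Product., b) ∈E C =
  (∃₂ λ xs ys → c C ∷ cs C ++ [ c C ] ≡ xs ++ a ∷ b ∷ ys) ⊎
  (∃₂ λ xs ys → c C ∷ cs C ++ [ c C ] ≡ xs ++ b ∷ a ∷ ys)

{-# OPTIONS --safe #-}

-- For n ≥ 4 the graph S_n^2 is Hamilton-connected. For n = 4 this is a finite check; as relabelling
-- symbols is an automorphism, it suffices to list Hamiltonian paths starting at the identity. For
-- n > 4 the blocks S_n^{2:p} are copies of S_(n-1)^2, and the moves (ii) and (iii) at position n
-- take x₁x₂⋯p into the blocks x₁ and x₂ respectively. Hamiltonian paths of successive blocks are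
-- chained by ending each block at a vertex with x₁ the next block and a fresh x₂; two vertices of
-- one block are joined by a detour through all the other blocks.
--
-- For the lemma, v is u with x₁x₂ replaced by x₂x₁ (move (i)), x₂xᵢ (move (ii)) or xᵢx₁ (move
-- (iii)). So either v has x₁ second, and the (iii)-moves at position n take v into block x₁ and u
-- into block x₂, or v starts with x₂, and the (ii)-moves take v into block x₂ and u into block x₁.
-- A Hamiltonian path from the neighbour of v through its block, the blocks of T and the other
-- block of {x₁, x₂} to the neighbour of u closes up with the edge u v into the required cycle.

module Submission where

open import Defs
open import Data.Bool using (if_then_else_)
open import Data.Empty using (⊥-elim)
open import Data.Fin using (Fin; zero; suc; fromℕ; inject₁; punchIn; punchOut; _≟_)
open import Data.Fin.Patterns using (0F; 1F; 2F; 3F)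
open import Data.Fin.Permutation.Components using (transpose; transpose-inverse)
open import Data.Fin.Properties
  using ( any?; all?; <⇒notInjective; punchOut-injective; inject₁-injective; fromℕ≢inject₁
        ; punchIn-injective; punchInᵢ≢i; punchIn-punchOut)
open import Data.Fin.Subset using (Subset) renaming (_∈_ to _∈ˢ_)
open import Data.Fin.Subset.Properties using () renaming (_∈?_ to _∈ˢ?_)
open import Data.List as List using (List; []; _∷_; _++_; [_]; head; last; map; length; filter; allFin)
open import Data.List.Properties using (++-assoc; map-++)
open import Data.List.Membership.Propositional using (_∈_; _∉_)
open import Data.List.Membership.Propositional.Properties
  using (∈-++⁺ˡ; ∈-++⁺ʳ; ∈-++⁻; ∈-map⁺; ∈-map⁻; ∈-filter⁺; ∈-filter⁻; ∈-allFin)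
open import Data.List.Relation.Unary.All as All using (All; []; _∷_)
import Data.List.Relation.Unary.All.Properties as All
open import Data.List.Relation.Unary.AllPairs as AllPairs using ([]; _∷_)
open import Data.List.Relation.Unary.Any as Any using (here; there)
open import Data.List.Relation.Unary.Any.Properties using (lookup-index)
open import Data.List.Relation.Unary.Linked as Linked using (Linked; [-]; _∷_; linked?)
import Data.List.Relation.Unary.Linked.Properties as Linked
open import Data.List.Relation.Unary.Unique.Propositional using (Unique)
import Data.List.Relation.Unary.Unique.Propositional.Properties as Unique
import Data.List.Relation.Unary.Unique.DecPropositional as Unique
open import Data.Maybe using (just; fromMaybe)
open import Data.Maybe.Relation.Binary.Connected using (Connected; just)
open import Data.Nat using (ℕ; zero; suc; 2+; _≤_; _<_; s≤s; z≤n; _/_; _%_)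
open import Data.Nat.Properties using (n<1+n)
open import Data.Product using (Σ; ∃; ∃₂; _×_; _,_; proj₁; proj₂)
open import Data.Sum using (_⊎_; inj₁; inj₂; [_,_]′; swap; map₂)
open import Data.Vec as Vec using (Vec; []; _∷_; lookup; toList; tabulate; _[_]≔_; _∷ʳ_)
open import Data.Vec.Properties
  using (tabulate∘lookup; lookup∘tabulate; lookup∘update; lookup∘update′; lookup-map; map-∘; ≡-dec)
open import Data.Vec.Relation.Binary.Pointwise.Extensional using (ext; Pointwise-≡⇒≡)
import Data.Vec.Relation.Unary.All.Properties as VecAll
open import Data.Vec.Relation.Unary.AllPairs using ([]; _∷_)
import Data.Vec.Relation.Unary.Unique.Propositional as VecUnique
import Data.Vec.Relation.Unary.Unique.Propositional.Properties as VecUnique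
open import Function using (_∘_)
open import Function.Bundles using (_⇔_; mk⇔; Equivalence)
open import Function.Definitions using (Injective)
import Function.Properties.Equivalence as ⇔
open import Level using (Level; 0ℓ)
open import Relation.Binary.Definitions using (DecidableEquality)
open import Relation.Binary.PropositionalEquality
  using (_≡_; _≢_; refl; sym; trans; cong; subst; subst₂; module ≡-Reasoning)
open import Relation.Nullary using (¬_; Dec; yes; no; does; ¬?; map′)
open import Relation.Nullary.Decidable
  using (toWitness; dec-true; dec-false; decidable-stable; _×-dec_; _⊎-dec_; _→-dec_)
open import Relation.Nullary.Negation using (contradiction)
open import Relation.Unary using (Pred; Decidable; _⊆_; _≐_; _∪_; _⊥_)

private
  variable
    m : ℕ

module _ {a : Level} {A : Set a} where

  toList-Unique⁻ : ∀ {n} {xs : Vec A n} → Unique (toList xs) → VecUnique.Unique xs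
  toList-Unique⁻ {xs = []}    []         = []
  toList-Unique⁻ {xs = _ ∷ _} (x∉ ∷ xs!) = VecAll.toList⁻ x∉ ∷ toList-Unique⁻ xs!

  toList-Unique⁺ : ∀ {n} {xs : Vec A n} → VecUnique.Unique xs → Unique (toList xs)
  toList-Unique⁺ []         = []
  toList-Unique⁺ (x∉ ∷ xs!) = VecAll.toList⁺ x∉ ∷ toList-Unique⁺ xs!

IsPerm⇒lookup-injective : {w : Str m} → IsPerm w → Injective _≡_ _≡_ (lookup w)
IsPerm⇒lookup-injective w! = VecUnique.lookup-injective (toList-Unique⁻ w!) _ _

lookup-injective⇒IsPerm : {w : Str m} → Injective _≡_ _≡_ (lookup w) → IsPerm w
lookup-injective⇒IsPerm {w = w} inj =
  subst IsPerm (tabulate∘lookup w) (toList-Unique⁺ (VecUnique.tabulate⁺ inj))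

injective⇒surjective : ∀ {n} (f : Fin n → Fin n) → Injective _≡_ _≡_ f →
                       ∀ a → ∃ λ i → f i ≡ a
injective⇒surjective {suc n} f inj a with any? (λ i → f i ≟ a)
... | yes hit = hit
... | no miss = ⊥-elim (<⇒notInjective (n<1+n n) skip-injective)
  where
  skip : Fin (suc n) → Fin n
  skip i = punchOut {i = a} {j = f i} (λ a≡fi → miss (i , sym a≡fi))
  skip-injective : Injective _≡_ _≡_ skip
  skip-injective = inj ∘ punchOut-injective {i = a} _ _

-- Moves and adjacency

data Move (m : ℕ) : Set where
  type-i           : Move m
  type-ii type-iii : Fin m → Move m

apply : Move m → Str m → Str m
apply type-i       = move-i
apply (type-ii k)  = move-ii k
apply (type-iii k) = move-iii k

inverse : Move m → Move m
inverse type-i       = type-i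
inverse (type-ii k)  = type-iii k
inverse (type-iii k) = type-ii k

inverse-involutive : (μ : Move m) → inverse (inverse μ) ≡ μ
inverse-involutive type-i       = refl
inverse-involutive (type-ii k)  = refl
inverse-involutive (type-iii k) = refl

redirect : Fin m → Fin (2+ m) → Fin m → Fin (2+ m)
redirect k a q = if does (q ≟ k) then a else suc (suc q)

redirect-self : ∀ (k : Fin m) a → redirect k a k ≡ a
redirect-self k a with k ≟ k
... | yes _  = refl
... | no k≢k = contradiction refl k≢k

redirect-other : ∀ {k q : Fin m} a → q ≢ k → redirect k a q ≡ suc (suc q)
redirect-other {k = k} {q} a q≢k with q ≟ k
... | yes q≡k = contradiction q≡k q≢k
... | no _    = refl

position : Move m → Fin (2+ m) → Fin (2+ m)
position type-i       zero            = suc zero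
position type-i       (suc zero)      = zero
position type-i       q@(suc (suc _)) = q
position (type-ii k)  zero            = suc zero
position (type-ii k)  (suc zero)      = suc (suc k)
position (type-ii k)  (suc (suc q))   = redirect k zero q
position (type-iii k) zero            = suc (suc k)
position (type-iii k) (suc zero)      = zero
position (type-iii k) (suc (suc q))   = redirect k (suc zero) q

lookup-redirect : ∀ (k : Fin m) p (u : Str m) q →
  lookup (Vec.tail (Vec.tail u) [ k ]≔ lookup u p) q ≡ lookup u (redirect k p q)
lookup-redirect k p (_ ∷ _ ∷ r) q with q ≟ k
... | yes refl = lookup∘update q r _
... | no q≢k   = lookup∘update′ q≢k r _

lookup-apply : ∀ (μ : Move m) u q → lookup (apply μ u) q ≡ lookup u (position μ q)
lookup-apply type-i       (_ ∷ _ ∷ _)   zero          = refl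
lookup-apply type-i       (_ ∷ _ ∷ _)   (suc zero)    = refl
lookup-apply type-i       (_ ∷ _ ∷ _)   (suc (suc q)) = refl
lookup-apply (type-ii k)  (_ ∷ _ ∷ _)   zero          = refl
lookup-apply (type-ii k)  (_ ∷ _ ∷ _)   (suc zero)    = refl
lookup-apply (type-ii k)  u@(_ ∷ _ ∷ _) (suc (suc q)) = lookup-redirect k zero u q
lookup-apply (type-iii k) (_ ∷ _ ∷ _)   zero          = refl
lookup-apply (type-iii k) (_ ∷ _ ∷ _)   (suc zero)    = refl
lookup-apply (type-iii k) u@(_ ∷ _ ∷ _) (suc (suc q)) = lookup-redirect k (suc zero) u q

position-inverseˡ : ∀ (μ : Move m) q → position (inverse μ) (position μ q) ≡ q
position-inverseˡ type-i       zero          = refl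
position-inverseˡ type-i       (suc zero)    = refl
position-inverseˡ type-i       (suc (suc q)) = refl
position-inverseˡ (type-ii k)  zero          = refl
position-inverseˡ (type-ii k)  (suc zero)    = redirect-self k (suc zero)
position-inverseˡ (type-ii k)  (suc (suc q)) with q ≟ k
... | yes refl = refl
... | no q≢k   = redirect-other (suc zero) q≢k
position-inverseˡ (type-iii k) zero          = redirect-self k zero
position-inverseˡ (type-iii k) (suc zero)    = refl
position-inverseˡ (type-iii k) (suc (suc q)) with q ≟ k
... | yes refl = refl
... | no q≢k   = redirect-other zero q≢k

position-inverseʳ : ∀ (μ : Move m) q → position μ (position (inverse μ) q) ≡ q
position-inverseʳ μ q = subst (λ ν → position ν (position (inverse μ) q) ≡ q)
                              (inverse-involutive μ) (position-inverseˡ (inverse μ) q)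

position-injective : (μ : Move m) → Injective _≡_ _≡_ (position μ)
position-injective μ {p} {q} eq =
  trans (sym (position-inverseˡ μ p)) (trans (cong (position (inverse μ)) eq) (position-inverseˡ μ q))

apply-inverse : ∀ (μ : Move m) u → apply (inverse μ) (apply μ u) ≡ u
apply-inverse μ u = Pointwise-≡⇒≡ (ext λ q → begin
  lookup (apply (inverse μ) (apply μ u)) q       ≡⟨ lookup-apply (inverse μ) (apply μ u) q ⟩
  lookup (apply μ u) (position (inverse μ) q)    ≡⟨ lookup-apply μ u _ ⟩
  lookup u (position μ (position (inverse μ) q)) ≡⟨ cong (lookup u) (position-inverseʳ μ q) ⟩
  lookup u q                                     ∎)
  where open ≡-Reasoning

apply-IsPerm : ∀ (μ : Move m) {u} → IsPerm u → IsPerm (apply μ u)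
apply-IsPerm μ {u} u! = lookup-injective⇒IsPerm λ {p} {q} eq →
  position-injective μ (IsPerm⇒lookup-injective u!
    (trans (sym (lookup-apply μ u p)) (trans eq (lookup-apply μ u q))))

Adj⇒Move : {u v : Str m} → Adj u v → ∃ λ μ → v ≡ apply μ u
Adj⇒Move (_ , inj₁ v≡)              = type-i , v≡
Adj⇒Move (_ , inj₂ (inj₁ (k , v≡))) = type-ii k , v≡
Adj⇒Move (_ , inj₂ (inj₂ (k , v≡))) = type-iii k , v≡

Move⇒Adj : ∀ (μ : Move m) {u v} → u ≢ v → v ≡ apply μ u → Adj u v
Move⇒Adj type-i       u≢v v≡ = u≢v , inj₁ v≡
Move⇒Adj (type-ii k)  u≢v v≡ = u≢v , inj₂ (inj₁ (k , v≡))
Move⇒Adj (type-iii k) u≢v v≡ = u≢v , inj₂ (inj₂ (k , v≡))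

Adj-sym : {u v : Str m} → Adj u v → Adj v u
Adj-sym {u = u} u~v@(u≢v , _) with Adj⇒Move u~v
... | μ , refl = Move⇒Adj (inverse μ) (u≢v ∘ sym) (sym (apply-inverse μ u))

IsPerm-resp-Adj : {u v : Str m} → Adj u v → IsPerm u → IsPerm v
IsPerm-resp-Adj u~v u! with Adj⇒Move u~v
... | μ , refl = apply-IsPerm μ u!

Adj-map : ∀ {m n} (F : Str m → Str n) (G : Move m → Move n) → Injective _≡_ _≡_ F →
          (∀ μ u → F (apply μ u) ≡ apply (G μ) (F u)) →
          ∀ {u v} → Adj u v → Adj (F u) (F v)
Adj-map F G F-inj F-apply {u} u~v@(u≢v , _) with Adj⇒Move u~v
... | μ , refl = Move⇒Adj (G μ) (u≢v ∘ F-inj) (F-apply μ u)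

-- Hamiltonian paths

module _ {a : Level} {A : Set a} where

  walk : A → List A → A → List A
  walk x mid y = x ∷ mid ++ [ y ]

  last-walk : ∀ x mid (y : A) → last (walk x mid y) ≡ just y
  last-walk x []        y = refl
  last-walk x (x′ ∷ xs) y = last-walk x′ xs y

  head-∷ʳ : ∀ xs (y : A) → head (xs ++ [ y ]) ≡ just (fromMaybe y (head xs))
  head-∷ʳ []      y = refl
  head-∷ʳ (_ ∷ _) y = refl

  walk-++ : ∀ x xs y x′ xs′ (y′ : A) →
            walk x xs y ++ walk x′ xs′ y′ ≡ walk x (xs ++ y ∷ x′ ∷ xs′) y′
  walk-++ x xs y x′ xs′ y′ =
    cong (x ∷_) (trans (++-assoc xs [ y ] _) (sym (++-assoc xs (y ∷ x′ ∷ xs′) [ y′ ])))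

  Linked-walk-++ : ∀ {ℓ} {R : A → A → Set ℓ} {x xs y x′ xs′ y′} →
                   Linked R (walk x xs y) → R y x′ → Linked R (walk x′ xs′ y′) →
                   Linked R (walk x (xs ++ y ∷ x′ ∷ xs′) y′)
  Linked-walk-++ {R = R} {x} {xs} {y} {x′} {xs′} {y′} l r l′ =
    subst (Linked R) (walk-++ x xs y x′ xs′ y′)
      (Linked.++⁺ l (subst (λ z → Connected R z (just x′)) (sym (last-walk x xs y)) (just r)) l′)

record HamiltonianPath {m} (P : Pred (Str m) 0ℓ) (a b : Str m) : Set where
  field
    interior : List (Str m)
    unique   : Unique (walk a interior b)
    linked   : Linked Adj (walk a interior b)
    sound    : ∀ {w} → w ∈ walk a interior b → P w
    complete : ∀ {w} → P w → w ∈ walk a interior b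

open HamiltonianPath

module _ {P Q : Pred (Str m) 0ℓ} where

  HamiltonianPath-resp : P ≐ Q → ∀ {a b} → HamiltonianPath P a b → HamiltonianPath Q a b
  HamiltonianPath-resp (P⊆Q , Q⊆P) h = record
    { interior = interior h ; unique = unique h ; linked = linked h
    ; sound    = P⊆Q ∘ sound h
    ; complete = complete h ∘ Q⊆P
    }

  join : ∀ {a b c d} → HamiltonianPath P a b → Adj b c → HamiltonianPath Q c d → P ⊥ Q →
         HamiltonianPath (P ∪ Q) a d
  join {a} {b} {c} {d} h b~c h′ P⊥Q = record
    { interior = interior h ++ b ∷ c ∷ interior h′
    ; unique   = subst Unique joined (Unique.++⁺ (unique h) (unique h′)
                                                 λ (w∈ , w∈′) → P⊥Q (sound h w∈ , sound h′ w∈′))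
    ; linked   = Linked-walk-++ (linked h) b~c (linked h′)
    ; sound    = λ {w} → [ inj₁ ∘ sound h , inj₂ ∘ sound h′ ]′
                         ∘ ∈-++⁻ first ∘ subst (w ∈_) (sym joined)
    ; complete = λ {w} → subst (w ∈_) joined
                         ∘ [ ∈-++⁺ˡ ∘ complete h , ∈-++⁺ʳ first ∘ complete h′ ]′
    }
    where
    first : List (Str m)
    first = walk a (interior h) b
    joined : first ++ walk c (interior h′) d ≡ walk a (interior h ++ b ∷ c ∷ interior h′) d
    joined = walk-++ a (interior h) b c (interior h′) d

module _ {P : Pred (Str m) 0ℓ} {a b : Str m} (h : HamiltonianPath P a b) where

  successor : Str m
  successor = fromMaybe b (head (interior h))

  rest : List (Str m)
  rest = interior h ++ [ b ]

  head-rest : head rest ≡ just successor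
  head-rest = head-∷ʳ (interior h) b

  successor-∈ : P successor
  successor-∈ = sound h (there (∈-head rest head-rest))
    where
    ∈-head : ∀ xs {x} → head xs ≡ just x → x ∈ xs
    ∈-head (_ ∷ _) refl = here refl

module _ {P Q : Pred (Str m) 0ℓ} where

  insert : ∀ {s t f e} (h : HamiltonianPath P s t) → Adj s f → HamiltonianPath Q f e →
           Adj e (successor h) → P ⊥ Q → HamiltonianPath (P ∪ Q) s t
  insert {s} {t} {f} {e} h s~f h′ e~s′ P⊥Q = record
    { interior = F ++ interior h
    ; unique   = subst Unique (sym reassoc)
                   (All.++⁺ (All.tabulate s∉F) s∉rest ∷ Unique.++⁺ (unique h′) rest! F⊥rest)
    ; linked   = subst (Linked Adj) (sym reassoc)
                   (s~f ∷ Linked.++⁺ (linked h′) e~rest (Linked.tail (linked h)))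
    ; sound    = λ {w} → sound′ ∘ subst (w ∈_) reassoc
    ; complete = λ {w} → subst (w ∈_) (sym reassoc) ∘ complete′
    }
    where
    F : List (Str m)
    F = walk f (interior h′) e
    reassoc : walk s (F ++ interior h) t ≡ s ∷ F ++ rest h
    reassoc = cong (s ∷_) (++-assoc F (interior h) [ t ])
    s∉rest : All (s ≢_) (rest h)
    s∉rest = AllPairs.head (unique h)
    rest! : Unique (rest h)
    rest! = AllPairs.tail (unique h)
    s∉F : ∀ {w} → w ∈ F → s ≢ w
    s∉F w∈ refl = P⊥Q (sound h (here refl) , sound h′ w∈)
    F⊥rest : ∀ {w} → ¬ (w ∈ F × w ∈ rest h)
    F⊥rest (w∈F , w∈rest) = P⊥Q (sound h (there w∈rest) , sound h′ w∈F)
    e~rest : Connected Adj (last F) (head (rest h))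
    e~rest = subst₂ (Connected Adj) (sym (last-walk f (interior h′) e)) (sym (head-rest h)) (just e~s′)
    sound′ : ∀ {w} → w ∈ s ∷ F ++ rest h → (P ∪ Q) w
    sound′ (here refl) = inj₁ (sound h (here refl))
    sound′ (there w∈) = [ inj₂ ∘ sound h′ , inj₁ ∘ sound h ∘ there ]′ (∈-++⁻ F w∈)
    complete′ : ∀ {w} → (P ∪ Q) w → w ∈ s ∷ F ++ rest h
    complete′ (inj₁ p) with complete h p
    ... | here refl = here refl
    ... | there w∈  = there (∈-++⁺ʳ F w∈)
    complete′ (inj₂ q) = there (∈-++⁺ˡ (complete h′ q))

image : ∀ {m n} {P : Pred (Str m) 0ℓ} {Q : Pred (Str n) 0ℓ} (F : Str m → Str n) →
        Injective _≡_ _≡_ F → (∀ {u v} → Adj u v → Adj (F u) (F v)) →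
        (∀ {u} → P u → Q (F u)) → (∀ {w} → Q w → ∃ λ u → P u × F u ≡ w) →
        ∀ {a b} → HamiltonianPath P a b → HamiltonianPath Q (F a) (F b)
image {P = P} {Q} F F-inj F-Adj P⇒Q Q⇒P {a} {b} h = record
  { interior = map F (interior h)
  ; unique   = subst Unique map-walk (Unique.map⁺ F-inj (unique h))
  ; linked   = subst (Linked Adj) map-walk (Linked.map⁺ (Linked.map F-Adj (linked h)))
  ; sound    = λ {w} → sound′ ∘ ∈-map⁻ F ∘ subst (w ∈_) (sym map-walk)
  ; complete = complete′ ∘ Q⇒P
  }
  where
  map-walk : map F (walk a (interior h) b) ≡ walk (F a) (map F (interior h)) (F b)
  map-walk = cong (F a ∷_) (map-++ F (interior h) [ b ])
  sound′ : ∀ {w} → (∃ λ u → u ∈ walk a (interior h) b × w ≡ F u) → Q w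
  sound′ (u , u∈ , refl) = P⇒Q (sound h u∈)
  complete′ : ∀ {w} → (∃ λ u → P u × F u ≡ w) → w ∈ walk (F a) (map F (interior h)) (F b)
  complete′ (u , p , refl) = subst (F u ∈_) map-walk (∈-map⁺ F (complete h p))

-- Relabelling symbols

module _ {n : ℕ} {f : Fin n → Fin n} (f-inj : Injective _≡_ _≡_ f) where

  section : Fin n → Fin n
  section a = proj₁ (injective⇒surjective f f-inj a)

  section-inverse : ∀ a → f (section a) ≡ a
  section-inverse a = proj₂ (injective⇒surjective f f-inj a)

  section-injective : Injective _≡_ _≡_ section
  section-injective {a} {b} eq = trans (sym (section-inverse a)) (trans (cong f eq) (section-inverse b))

module _ (f : Fin (2+ m) → Fin (2+ m)) where

  relabel-apply : ∀ (μ : Move m) u → Vec.map f (apply μ u) ≡ apply μ (Vec.map f u)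
  relabel-apply μ u = Pointwise-≡⇒≡ (ext λ q → begin
    lookup (Vec.map f (apply μ u)) q    ≡⟨ lookup-map q f (apply μ u) ⟩
    f (lookup (apply μ u) q)            ≡⟨ cong f (lookup-apply μ u q) ⟩
    f (lookup u (position μ q))         ≡⟨ lookup-map (position μ q) f u ⟨
    lookup (Vec.map f u) (position μ q) ≡⟨ lookup-apply μ (Vec.map f u) q ⟨
    lookup (apply μ (Vec.map f u)) q    ∎)
    where open ≡-Reasoning

module _ {f : Fin (2+ m) → Fin (2+ m)} (f-inj : Injective _≡_ _≡_ f) where

  relabel-injective : Injective _≡_ _≡_ (Vec.map {n = 2+ m} f)
  relabel-injective {u} {v} eq = Pointwise-≡⇒≡ (ext λ q →
    f-inj (trans (sym (lookup-map q f u)) (trans (cong (λ w → lookup w q) eq) (lookup-map q f v))))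

  relabel-IsPerm : ∀ {u : Str m} → IsPerm u → IsPerm (Vec.map f u)
  relabel-IsPerm {u} u! = lookup-injective⇒IsPerm λ {p} {q} eq →
    IsPerm⇒lookup-injective u! (f-inj (trans (sym (lookup-map p f u)) (trans eq (lookup-map q f u))))

module _ {f : Fin (2+ m) → Fin (2+ m)} (f-inj : Injective _≡_ _≡_ f) where

  relabel-onto : ∀ {w : Str m} → IsPerm w → ∃ λ u → IsPerm u × Vec.map f u ≡ w
  relabel-onto {w} w! =
      Vec.map (section f-inj) w
    , relabel-IsPerm (section-injective f-inj) w!
    , Pointwise-≡⇒≡ (ext λ q → trans (cong (λ z → lookup z q) (sym (map-∘ f (section f-inj) w)))
                                 (trans (lookup-map q _ w) (section-inverse f-inj _)))

  relabel-HamiltonianPath : ∀ {a b} → HamiltonianPath IsPerm a b →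
                            HamiltonianPath IsPerm (Vec.map f a) (Vec.map f b)
  relabel-HamiltonianPath = image (Vec.map f) (relabel-injective f-inj)
    (Adj-map (Vec.map f) (λ μ → μ) (relabel-injective f-inj) (relabel-apply f))
    (relabel-IsPerm f-inj) relabel-onto

-- Blocks

Block : Fin (2+ m) → Pred (Str m) 0ℓ
Block p w = IsPerm w × lastSym w ≡ p

data LastView {n : ℕ} : Fin (suc n) → Set where
  inner : ∀ r → LastView (inject₁ r)
  final : LastView (fromℕ n)

last-view : ∀ {n} (q : Fin (suc n)) → LastView q
last-view {zero}  zero    = final
last-view {suc n} zero    = inner zero
last-view {suc n} (suc q) with last-view q
... | inner r = inner (suc r)
... | final   = final

module _ {a : Level} {A : Set a} where

  lookup-∷ʳ-inject₁ : ∀ {n} (xs : Vec A n) x r → lookup (xs ∷ʳ x) (inject₁ r) ≡ lookup xs r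
  lookup-∷ʳ-inject₁ (_ ∷ _)  x zero    = refl
  lookup-∷ʳ-inject₁ (_ ∷ xs) x (suc r) = lookup-∷ʳ-inject₁ xs x r

  lookup-∷ʳ-last : ∀ {n} (xs : Vec A n) x → lookup (xs ∷ʳ x) (fromℕ n) ≡ x
  lookup-∷ʳ-last []       x = refl
  lookup-∷ʳ-last (_ ∷ xs) x = lookup-∷ʳ-last xs x

-- x, read as a string over [n] ∖ {p}, followed by p.
lift : Fin (2+ (suc m)) → Str m → Str (suc m)
lift p x = Vec.map (punchIn p) x ∷ʳ p

lookup-lift : ∀ p (x : Str m) r → lookup (lift p x) (inject₁ r) ≡ punchIn p (lookup x r)
lookup-lift p x r = trans (lookup-∷ʳ-inject₁ (Vec.map (punchIn p) x) p r) (lookup-map r (punchIn p) x)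

lastSym-lift : ∀ p (x : Str m) → lastSym (lift p x) ≡ p
lastSym-lift p x = lookup-∷ʳ-last (Vec.map (punchIn p) x) p

lift-injective : ∀ (p : Fin (2+ (suc m))) → Injective _≡_ _≡_ (lift {m} p)
lift-injective p {x} {y} eq = Pointwise-≡⇒≡ (ext λ r → punchIn-injective p _ _ (begin
  punchIn p (lookup x r)        ≡⟨ lookup-lift p x r ⟨
  lookup (lift p x) (inject₁ r) ≡⟨ cong (λ w → lookup w (inject₁ r)) eq ⟩
  lookup (lift p y) (inject₁ r) ≡⟨ lookup-lift p y r ⟩
  punchIn p (lookup y r)        ∎))
  where open ≡-Reasoning

lift-IsPerm : ∀ p {x : Str m} → IsPerm x → IsPerm (lift p x)
lift-IsPerm p {x} x! = lookup-injective⇒IsPerm λ {i} {j} → injective (last-view i) (last-view j)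
  where
  inner≢final : ∀ r → lookup (lift p x) (inject₁ r) ≢ lastSym (lift p x)
  inner≢final r eq = punchInᵢ≢i p _ (trans (sym (lookup-lift p x r)) (trans eq (lastSym-lift p x)))
  injective : ∀ {i j} → LastView i → LastView j →
              lookup (lift p x) i ≡ lookup (lift p x) j → i ≡ j
  injective (inner r) (inner s) eq = cong inject₁ (IsPerm⇒lookup-injective x!
    (punchIn-injective p _ _ (trans (sym (lookup-lift p x r)) (trans eq (lookup-lift p x s)))))
  injective (inner r) final     eq = contradiction eq (inner≢final r)
  injective final     (inner s) eq = contradiction (sym eq) (inner≢final s)
  injective final     final     _  = refl

lift-onto : ∀ p {w : Str (suc m)} → Block p w → ∃ λ x → IsPerm x × lift p x ≡ w
lift-onto {m} p {w} (w! , refl) =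
  x , lookup-injective⇒IsPerm x-injective , Pointwise-≡⇒≡ (ext λ q → lift-x (last-view q))
  where
  p≢ : ∀ r → lastSym w ≢ lookup w (inject₁ r)
  p≢ r = fromℕ≢inject₁ ∘ IsPerm⇒lookup-injective w!
  x-at : Fin (2+ m) → Fin (2+ m)
  x-at r = punchOut (p≢ r)
  x : Str m
  x = tabulate x-at
  x-injective : Injective _≡_ _≡_ (lookup x)
  x-injective {r} {s} eq = inject₁-injective (IsPerm⇒lookup-injective w! (punchOut-injective (p≢ r) (p≢ s)
    (trans (sym (lookup∘tabulate x-at r)) (trans eq (lookup∘tabulate x-at s)))))
  lift-x : ∀ {q} → LastView q → lookup (lift (lastSym w) x) q ≡ lookup w q
  lift-x (inner r) = trans (lookup-lift _ x r)
    (trans (cong (punchIn _) (lookup∘tabulate x-at r)) (punchIn-punchOut (p≢ r)))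
  lift-x final     = lastSym-lift _ x

liftMove : Move m → Move (suc m)
liftMove type-i       = type-i
liftMove (type-ii k)  = type-ii (inject₁ k)
liftMove (type-iii k) = type-iii (inject₁ k)

redirect-inject₁ : ∀ (k : Fin m) a q →
                   redirect (inject₁ k) (inject₁ a) (inject₁ q) ≡ inject₁ (redirect k a q)
redirect-inject₁ k a q with q ≟ k
... | yes refl = redirect-self (inject₁ q) (inject₁ a)
... | no q≢k   = redirect-other (inject₁ a) (q≢k ∘ inject₁-injective)

position-lift : ∀ (μ : Move m) r → position (liftMove μ) (inject₁ r) ≡ inject₁ (position μ r)
position-lift type-i       zero          = refl
position-lift type-i       (suc zero)    = refl
position-lift type-i       (suc (suc r)) = refl
position-lift (type-ii k)  zero          = refl
position-lift (type-ii k)  (suc zero)    = refl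
position-lift (type-ii k)  (suc (suc r)) = redirect-inject₁ k zero r
position-lift (type-iii k) zero          = refl
position-lift (type-iii k) (suc zero)    = refl
position-lift (type-iii k) (suc (suc r)) = redirect-inject₁ k (suc zero) r

position-lift-last : ∀ (μ : Move m) → position (liftMove μ) (fromℕ _) ≡ fromℕ _
position-lift-last type-i       = refl
position-lift-last (type-ii k)  = redirect-other zero fromℕ≢inject₁
position-lift-last (type-iii k) = redirect-other (suc zero) fromℕ≢inject₁

lift-apply : ∀ p (μ : Move m) x → lift p (apply μ x) ≡ apply (liftMove μ) (lift p x)
lift-apply p μ x = Pointwise-≡⇒≡ (ext λ q → commute (last-view q))
  where
  open ≡-Reasoning
  x′ : Str (suc _)
  x′ = lift p x
  μ′ : Move (suc _)
  μ′ = liftMove μ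
  commute : ∀ {q} → LastView q → lookup (lift p (apply μ x)) q ≡ lookup (apply μ′ x′) q
  commute (inner r) = begin
    lookup (lift p (apply μ x)) (inject₁ r)  ≡⟨ lookup-lift p (apply μ x) r ⟩
    punchIn p (lookup (apply μ x) r)         ≡⟨ cong (punchIn p) (lookup-apply μ x r) ⟩
    punchIn p (lookup x (position μ r))      ≡⟨ lookup-lift p x (position μ r) ⟨
    lookup x′ (inject₁ (position μ r))       ≡⟨ cong (lookup x′) (position-lift μ r) ⟨
    lookup x′ (position μ′ (inject₁ r))      ≡⟨ lookup-apply μ′ x′ (inject₁ r) ⟨
    lookup (apply μ′ x′) (inject₁ r)         ∎
  commute final = begin
    lastSym (lift p (apply μ x))             ≡⟨ lastSym-lift p (apply μ x) ⟩
    p                                        ≡⟨ lastSym-lift p x ⟨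
    lastSym x′                               ≡⟨ cong (lookup x′) (position-lift-last μ) ⟨
    lookup x′ (position μ′ (fromℕ _))        ≡⟨ lookup-apply μ′ x′ (fromℕ _) ⟨
    lastSym (apply μ′ x′)                    ∎

HamiltonConnected : ℕ → Set
HamiltonConnected m = ∀ {s t : Str m} → IsPerm s → IsPerm t → s ≢ t → HamiltonianPath IsPerm s t

block-HamiltonianPath : HamiltonConnected m → ∀ {p} {s t : Str (suc m)} →
                        Block p s → Block p t → s ≢ t → HamiltonianPath (Block p) s t
block-HamiltonianPath hc {p} s∈p t∈p s≢t with lift-onto p s∈p | lift-onto p t∈p
... | x , x! , refl | y , y! , refl =
  image (lift p) (lift-injective p) (Adj-map (lift p) liftMove (lift-injective p) (lift-apply p))
    (λ {x} x! → lift-IsPerm p x! , lastSym-lift p x) (lift-onto p)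
    (hc x! y! (s≢t ∘ cong (lift p)))

-- S_4^2 is Hamilton-connected

_≟ˢ_ : DecidableEquality (Str m)
_≟ˢ_ = ≡-dec _≟_

IsPerm? : Decidable (IsPerm {m})
IsPerm? w = Unique.unique? _≟_ (toList w)

Adj? : (u v : Str m) → Dec (Adj u v)
Adj? u v = ¬? (u ≟ˢ v) ×-dec ((v ≟ˢ move-i u) ⊎-dec
             (any? (λ k → v ≟ˢ move-ii k u) ⊎-dec any? (λ k → v ≟ˢ move-iii k u)))

all-Str? : {P : Str 2 → Set} → Decidable P → Dec (∀ w → P w)
all-Str? P? = map′ (λ h → λ { (a ∷ b ∷ c ∷ d ∷ []) → h a b c d }) (λ h a b c d → h _)
                   (all? λ a → all? λ b → all? λ c → all? λ d → P? _)

digit : ℕ → Fin 4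
digit 0 = 0F
digit 1 = 1F
digit 2 = 2F
digit _ = 3F

-- ⟪ abcd ⟫ is the string a b c d (a digit above 3 would be read as 3).
⟪_⟫ : ℕ → Str 2
⟪ n ⟫ = digit (n / 1000) ∷ digit (n / 100 % 10) ∷ digit (n / 10 % 10) ∷ digit (n % 10) ∷ []

identity : Str 2
identity = 0F ∷ 1F ∷ 2F ∷ 3F ∷ []

Certificate : Str 2 × List (Str 2) → Set
Certificate (t , mid) =
  Unique (walk identity mid t) × Linked Adj (walk identity mid t) ×
  All IsPerm (walk identity mid t) × (∀ w → IsPerm w → w ∈ walk identity mid t)

certificate? : Decidable Certificate
certificate? (t , mid) =
  Unique.unique? _≟ˢ_ _ ×-dec linked? Adj? _ ×-dec All.all? IsPerm? _ ×-dec
  all-Str? (λ w → IsPerm? w →-dec Any.any? (w ≟ˢ_) (walk identity mid t))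

certificates : List (Str 2 × List (Str 2))
certificates =
  (⟪ 0132 ⟫ , ⟪ 1023 ⟫ ∷ ⟪ 0213 ⟫ ∷ ⟪ 2013 ⟫ ∷ ⟪ 1203 ⟫ ∷ ⟪ 2103 ⟫ ∷ ⟪ 1302 ⟫ ∷ ⟪ 3102 ⟫ ∷ ⟪ 1032 ⟫
             ∷ ⟪ 0312 ⟫ ∷ ⟪ 3012 ⟫ ∷ ⟪ 2310 ⟫ ∷ ⟪ 3210 ⟫ ∷ ⟪ 2130 ⟫ ∷ ⟪ 1230 ⟫ ∷ ⟪ 3120 ⟫
             ∷ ⟪ 1320 ⟫ ∷ ⟪ 3021 ⟫ ∷ ⟪ 0321 ⟫ ∷ ⟪ 3201 ⟫ ∷ ⟪ 2301 ⟫ ∷ ⟪ 0231 ⟫ ∷ ⟪ 2031 ⟫ ∷ []) ∷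
  (⟪ 0213 ⟫ , ⟪ 1023 ⟫ ∷ ⟪ 2103 ⟫ ∷ ⟪ 1203 ⟫ ∷ ⟪ 2013 ⟫ ∷ ⟪ 0312 ⟫ ∷ ⟪ 3012 ⟫ ∷ ⟪ 0132 ⟫ ∷ ⟪ 1032 ⟫
             ∷ ⟪ 3102 ⟫ ∷ ⟪ 1302 ⟫ ∷ ⟪ 3201 ⟫ ∷ ⟪ 2301 ⟫ ∷ ⟪ 3021 ⟫ ∷ ⟪ 0321 ⟫ ∷ ⟪ 2031 ⟫
             ∷ ⟪ 0231 ⟫ ∷ ⟪ 2130 ⟫ ∷ ⟪ 1230 ⟫ ∷ ⟪ 3120 ⟫ ∷ ⟪ 1320 ⟫ ∷ ⟪ 3210 ⟫ ∷ ⟪ 2310 ⟫ ∷ []) ∷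
  (⟪ 0231 ⟫ , ⟪ 1023 ⟫ ∷ ⟪ 0213 ⟫ ∷ ⟪ 2013 ⟫ ∷ ⟪ 1203 ⟫ ∷ ⟪ 2103 ⟫ ∷ ⟪ 1302 ⟫ ∷ ⟪ 3102 ⟫ ∷ ⟪ 1032 ⟫
             ∷ ⟪ 0132 ⟫ ∷ ⟪ 3012 ⟫ ∷ ⟪ 0312 ⟫ ∷ ⟪ 3210 ⟫ ∷ ⟪ 2310 ⟫ ∷ ⟪ 3120 ⟫ ∷ ⟪ 1320 ⟫
             ∷ ⟪ 2130 ⟫ ∷ ⟪ 1230 ⟫ ∷ ⟪ 2031 ⟫ ∷ ⟪ 0321 ⟫ ∷ ⟪ 3201 ⟫ ∷ ⟪ 2301 ⟫ ∷ ⟪ 3021 ⟫ ∷ []) ∷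
  (⟪ 0312 ⟫ , ⟪ 1023 ⟫ ∷ ⟪ 0213 ⟫ ∷ ⟪ 2013 ⟫ ∷ ⟪ 1203 ⟫ ∷ ⟪ 2103 ⟫ ∷ ⟪ 1302 ⟫ ∷ ⟪ 3102 ⟫ ∷ ⟪ 1032 ⟫
             ∷ ⟪ 0132 ⟫ ∷ ⟪ 3012 ⟫ ∷ ⟪ 2310 ⟫ ∷ ⟪ 3120 ⟫ ∷ ⟪ 1320 ⟫ ∷ ⟪ 3021 ⟫ ∷ ⟪ 0321 ⟫
             ∷ ⟪ 3201 ⟫ ∷ ⟪ 2301 ⟫ ∷ ⟪ 0231 ⟫ ∷ ⟪ 2031 ⟫ ∷ ⟪ 1230 ⟫ ∷ ⟪ 2130 ⟫ ∷ ⟪ 3210 ⟫ ∷ []) ∷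
  (⟪ 0321 ⟫ , ⟪ 1023 ⟫ ∷ ⟪ 0213 ⟫ ∷ ⟪ 2013 ⟫ ∷ ⟪ 1203 ⟫ ∷ ⟪ 2103 ⟫ ∷ ⟪ 1302 ⟫ ∷ ⟪ 3102 ⟫ ∷ ⟪ 1032 ⟫
             ∷ ⟪ 0132 ⟫ ∷ ⟪ 3012 ⟫ ∷ ⟪ 0312 ⟫ ∷ ⟪ 3210 ⟫ ∷ ⟪ 2310 ⟫ ∷ ⟪ 3120 ⟫ ∷ ⟪ 1320 ⟫
             ∷ ⟪ 2130 ⟫ ∷ ⟪ 1230 ⟫ ∷ ⟪ 2031 ⟫ ∷ ⟪ 0231 ⟫ ∷ ⟪ 3021 ⟫ ∷ ⟪ 2301 ⟫ ∷ ⟪ 3201 ⟫ ∷ []) ∷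
  (⟪ 1023 ⟫ , ⟪ 1203 ⟫ ∷ ⟪ 2103 ⟫ ∷ ⟪ 0213 ⟫ ∷ ⟪ 2013 ⟫ ∷ ⟪ 0312 ⟫ ∷ ⟪ 3012 ⟫ ∷ ⟪ 0132 ⟫ ∷ ⟪ 1032 ⟫
             ∷ ⟪ 3102 ⟫ ∷ ⟪ 1302 ⟫ ∷ ⟪ 3201 ⟫ ∷ ⟪ 2301 ⟫ ∷ ⟪ 3021 ⟫ ∷ ⟪ 0321 ⟫ ∷ ⟪ 2031 ⟫
             ∷ ⟪ 0231 ⟫ ∷ ⟪ 2130 ⟫ ∷ ⟪ 1230 ⟫ ∷ ⟪ 2310 ⟫ ∷ ⟪ 3210 ⟫ ∷ ⟪ 1320 ⟫ ∷ ⟪ 3120 ⟫ ∷ []) ∷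
  (⟪ 1032 ⟫ , ⟪ 1023 ⟫ ∷ ⟪ 0213 ⟫ ∷ ⟪ 2013 ⟫ ∷ ⟪ 1203 ⟫ ∷ ⟪ 2103 ⟫ ∷ ⟪ 1302 ⟫ ∷ ⟪ 3102 ⟫ ∷ ⟪ 0312 ⟫
             ∷ ⟪ 3012 ⟫ ∷ ⟪ 0132 ⟫ ∷ ⟪ 1230 ⟫ ∷ ⟪ 2130 ⟫ ∷ ⟪ 1320 ⟫ ∷ ⟪ 3210 ⟫ ∷ ⟪ 2310 ⟫
             ∷ ⟪ 3120 ⟫ ∷ ⟪ 0321 ⟫ ∷ ⟪ 3021 ⟫ ∷ ⟪ 2301 ⟫ ∷ ⟪ 3201 ⟫ ∷ ⟪ 2031 ⟫ ∷ ⟪ 0231 ⟫ ∷ []) ∷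
  (⟪ 1203 ⟫ , ⟪ 1023 ⟫ ∷ ⟪ 0213 ⟫ ∷ ⟪ 2013 ⟫ ∷ ⟪ 0312 ⟫ ∷ ⟪ 3012 ⟫ ∷ ⟪ 0132 ⟫ ∷ ⟪ 1032 ⟫ ∷ ⟪ 3102 ⟫
             ∷ ⟪ 1302 ⟫ ∷ ⟪ 2103 ⟫ ∷ ⟪ 3201 ⟫ ∷ ⟪ 2031 ⟫ ∷ ⟪ 0231 ⟫ ∷ ⟪ 2130 ⟫ ∷ ⟪ 1230 ⟫
             ∷ ⟪ 2310 ⟫ ∷ ⟪ 3210 ⟫ ∷ ⟪ 1320 ⟫ ∷ ⟪ 3120 ⟫ ∷ ⟪ 0321 ⟫ ∷ ⟪ 3021 ⟫ ∷ ⟪ 2301 ⟫ ∷ []) ∷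
  (⟪ 1230 ⟫ , ⟪ 1023 ⟫ ∷ ⟪ 0213 ⟫ ∷ ⟪ 2013 ⟫ ∷ ⟪ 1203 ⟫ ∷ ⟪ 2103 ⟫ ∷ ⟪ 1302 ⟫ ∷ ⟪ 3102 ⟫ ∷ ⟪ 1032 ⟫
             ∷ ⟪ 0132 ⟫ ∷ ⟪ 3012 ⟫ ∷ ⟪ 0312 ⟫ ∷ ⟪ 3210 ⟫ ∷ ⟪ 2310 ⟫ ∷ ⟪ 3120 ⟫ ∷ ⟪ 1320 ⟫
             ∷ ⟪ 2130 ⟫ ∷ ⟪ 0231 ⟫ ∷ ⟪ 2301 ⟫ ∷ ⟪ 3021 ⟫ ∷ ⟪ 0321 ⟫ ∷ ⟪ 3201 ⟫ ∷ ⟪ 2031 ⟫ ∷ []) ∷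
  (⟪ 1302 ⟫ , ⟪ 1023 ⟫ ∷ ⟪ 0213 ⟫ ∷ ⟪ 2013 ⟫ ∷ ⟪ 1203 ⟫ ∷ ⟪ 2103 ⟫ ∷ ⟪ 3201 ⟫ ∷ ⟪ 2301 ⟫ ∷ ⟪ 3021 ⟫
             ∷ ⟪ 0321 ⟫ ∷ ⟪ 2031 ⟫ ∷ ⟪ 0231 ⟫ ∷ ⟪ 2130 ⟫ ∷ ⟪ 1230 ⟫ ∷ ⟪ 2310 ⟫ ∷ ⟪ 3120 ⟫
             ∷ ⟪ 1320 ⟫ ∷ ⟪ 3210 ⟫ ∷ ⟪ 0312 ⟫ ∷ ⟪ 3012 ⟫ ∷ ⟪ 0132 ⟫ ∷ ⟪ 1032 ⟫ ∷ ⟪ 3102 ⟫ ∷ []) ∷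
  (⟪ 1320 ⟫ , ⟪ 1023 ⟫ ∷ ⟪ 0213 ⟫ ∷ ⟪ 2013 ⟫ ∷ ⟪ 1203 ⟫ ∷ ⟪ 2103 ⟫ ∷ ⟪ 1302 ⟫ ∷ ⟪ 3102 ⟫ ∷ ⟪ 1032 ⟫
             ∷ ⟪ 0132 ⟫ ∷ ⟪ 3012 ⟫ ∷ ⟪ 0312 ⟫ ∷ ⟪ 3210 ⟫ ∷ ⟪ 2310 ⟫ ∷ ⟪ 3120 ⟫ ∷ ⟪ 1230 ⟫
             ∷ ⟪ 2130 ⟫ ∷ ⟪ 0231 ⟫ ∷ ⟪ 2031 ⟫ ∷ ⟪ 0321 ⟫ ∷ ⟪ 3201 ⟫ ∷ ⟪ 2301 ⟫ ∷ ⟪ 3021 ⟫ ∷ []) ∷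
  (⟪ 2013 ⟫ , ⟪ 1023 ⟫ ∷ ⟪ 0213 ⟫ ∷ ⟪ 2103 ⟫ ∷ ⟪ 1203 ⟫ ∷ ⟪ 2301 ⟫ ∷ ⟪ 3201 ⟫ ∷ ⟪ 2031 ⟫ ∷ ⟪ 0231 ⟫
             ∷ ⟪ 3021 ⟫ ∷ ⟪ 0321 ⟫ ∷ ⟪ 3120 ⟫ ∷ ⟪ 1320 ⟫ ∷ ⟪ 3210 ⟫ ∷ ⟪ 2310 ⟫ ∷ ⟪ 1230 ⟫
             ∷ ⟪ 2130 ⟫ ∷ ⟪ 1032 ⟫ ∷ ⟪ 0132 ⟫ ∷ ⟪ 3012 ⟫ ∷ ⟪ 1302 ⟫ ∷ ⟪ 3102 ⟫ ∷ ⟪ 0312 ⟫ ∷ []) ∷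
  (⟪ 2031 ⟫ , ⟪ 1023 ⟫ ∷ ⟪ 0213 ⟫ ∷ ⟪ 2013 ⟫ ∷ ⟪ 1203 ⟫ ∷ ⟪ 2103 ⟫ ∷ ⟪ 1302 ⟫ ∷ ⟪ 3102 ⟫ ∷ ⟪ 1032 ⟫
             ∷ ⟪ 0132 ⟫ ∷ ⟪ 3012 ⟫ ∷ ⟪ 0312 ⟫ ∷ ⟪ 3210 ⟫ ∷ ⟪ 2310 ⟫ ∷ ⟪ 3120 ⟫ ∷ ⟪ 1320 ⟫
             ∷ ⟪ 3021 ⟫ ∷ ⟪ 0321 ⟫ ∷ ⟪ 3201 ⟫ ∷ ⟪ 2301 ⟫ ∷ ⟪ 0231 ⟫ ∷ ⟪ 2130 ⟫ ∷ ⟪ 1230 ⟫ ∷ []) ∷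
  (⟪ 2103 ⟫ , ⟪ 1023 ⟫ ∷ ⟪ 0213 ⟫ ∷ ⟪ 2013 ⟫ ∷ ⟪ 1203 ⟫ ∷ ⟪ 2301 ⟫ ∷ ⟪ 3201 ⟫ ∷ ⟪ 2031 ⟫ ∷ ⟪ 0231 ⟫
             ∷ ⟪ 3021 ⟫ ∷ ⟪ 0321 ⟫ ∷ ⟪ 3120 ⟫ ∷ ⟪ 1320 ⟫ ∷ ⟪ 3210 ⟫ ∷ ⟪ 2310 ⟫ ∷ ⟪ 1230 ⟫
             ∷ ⟪ 2130 ⟫ ∷ ⟪ 1032 ⟫ ∷ ⟪ 0132 ⟫ ∷ ⟪ 3012 ⟫ ∷ ⟪ 0312 ⟫ ∷ ⟪ 3102 ⟫ ∷ ⟪ 1302 ⟫ ∷ []) ∷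
  (⟪ 2130 ⟫ , ⟪ 1023 ⟫ ∷ ⟪ 0213 ⟫ ∷ ⟪ 2013 ⟫ ∷ ⟪ 1203 ⟫ ∷ ⟪ 2103 ⟫ ∷ ⟪ 1302 ⟫ ∷ ⟪ 3102 ⟫ ∷ ⟪ 1032 ⟫
             ∷ ⟪ 0132 ⟫ ∷ ⟪ 3012 ⟫ ∷ ⟪ 0312 ⟫ ∷ ⟪ 3210 ⟫ ∷ ⟪ 2310 ⟫ ∷ ⟪ 3120 ⟫ ∷ ⟪ 1320 ⟫
             ∷ ⟪ 3021 ⟫ ∷ ⟪ 0321 ⟫ ∷ ⟪ 3201 ⟫ ∷ ⟪ 2301 ⟫ ∷ ⟪ 0231 ⟫ ∷ ⟪ 2031 ⟫ ∷ ⟪ 1230 ⟫ ∷ []) ∷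
  (⟪ 2301 ⟫ , ⟪ 1023 ⟫ ∷ ⟪ 0213 ⟫ ∷ ⟪ 2013 ⟫ ∷ ⟪ 1203 ⟫ ∷ ⟪ 2103 ⟫ ∷ ⟪ 1302 ⟫ ∷ ⟪ 3102 ⟫ ∷ ⟪ 1032 ⟫
             ∷ ⟪ 0132 ⟫ ∷ ⟪ 3012 ⟫ ∷ ⟪ 0312 ⟫ ∷ ⟪ 3210 ⟫ ∷ ⟪ 2310 ⟫ ∷ ⟪ 3120 ⟫ ∷ ⟪ 1320 ⟫
             ∷ ⟪ 2130 ⟫ ∷ ⟪ 1230 ⟫ ∷ ⟪ 2031 ⟫ ∷ ⟪ 0231 ⟫ ∷ ⟪ 3021 ⟫ ∷ ⟪ 0321 ⟫ ∷ ⟪ 3201 ⟫ ∷ []) ∷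
  (⟪ 2310 ⟫ , ⟪ 1023 ⟫ ∷ ⟪ 0213 ⟫ ∷ ⟪ 2013 ⟫ ∷ ⟪ 1203 ⟫ ∷ ⟪ 2103 ⟫ ∷ ⟪ 1302 ⟫ ∷ ⟪ 3102 ⟫ ∷ ⟪ 1032 ⟫
             ∷ ⟪ 0132 ⟫ ∷ ⟪ 3012 ⟫ ∷ ⟪ 0312 ⟫ ∷ ⟪ 3210 ⟫ ∷ ⟪ 2130 ⟫ ∷ ⟪ 1230 ⟫ ∷ ⟪ 2031 ⟫
             ∷ ⟪ 0231 ⟫ ∷ ⟪ 2301 ⟫ ∷ ⟪ 3201 ⟫ ∷ ⟪ 0321 ⟫ ∷ ⟪ 3021 ⟫ ∷ ⟪ 1320 ⟫ ∷ ⟪ 3120 ⟫ ∷ []) ∷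
  (⟪ 3012 ⟫ , ⟪ 1023 ⟫ ∷ ⟪ 0213 ⟫ ∷ ⟪ 2013 ⟫ ∷ ⟪ 1203 ⟫ ∷ ⟪ 2103 ⟫ ∷ ⟪ 1302 ⟫ ∷ ⟪ 3102 ⟫ ∷ ⟪ 1032 ⟫
             ∷ ⟪ 0132 ⟫ ∷ ⟪ 1230 ⟫ ∷ ⟪ 2130 ⟫ ∷ ⟪ 1320 ⟫ ∷ ⟪ 3021 ⟫ ∷ ⟪ 0231 ⟫ ∷ ⟪ 2301 ⟫
             ∷ ⟪ 3201 ⟫ ∷ ⟪ 2031 ⟫ ∷ ⟪ 0321 ⟫ ∷ ⟪ 3120 ⟫ ∷ ⟪ 2310 ⟫ ∷ ⟪ 3210 ⟫ ∷ ⟪ 0312 ⟫ ∷ []) ∷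
  (⟪ 3021 ⟫ , ⟪ 1023 ⟫ ∷ ⟪ 0213 ⟫ ∷ ⟪ 2013 ⟫ ∷ ⟪ 1203 ⟫ ∷ ⟪ 2103 ⟫ ∷ ⟪ 1302 ⟫ ∷ ⟪ 3102 ⟫ ∷ ⟪ 1032 ⟫
             ∷ ⟪ 0132 ⟫ ∷ ⟪ 3012 ⟫ ∷ ⟪ 0312 ⟫ ∷ ⟪ 3210 ⟫ ∷ ⟪ 2310 ⟫ ∷ ⟪ 3120 ⟫ ∷ ⟪ 1320 ⟫
             ∷ ⟪ 2130 ⟫ ∷ ⟪ 1230 ⟫ ∷ ⟪ 2031 ⟫ ∷ ⟪ 0231 ⟫ ∷ ⟪ 2301 ⟫ ∷ ⟪ 3201 ⟫ ∷ ⟪ 0321 ⟫ ∷ []) ∷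
  (⟪ 3102 ⟫ , ⟪ 1023 ⟫ ∷ ⟪ 0213 ⟫ ∷ ⟪ 2013 ⟫ ∷ ⟪ 1203 ⟫ ∷ ⟪ 2103 ⟫ ∷ ⟪ 1302 ⟫ ∷ ⟪ 3012 ⟫ ∷ ⟪ 0312 ⟫
             ∷ ⟪ 1032 ⟫ ∷ ⟪ 0132 ⟫ ∷ ⟪ 1230 ⟫ ∷ ⟪ 2130 ⟫ ∷ ⟪ 1320 ⟫ ∷ ⟪ 3210 ⟫ ∷ ⟪ 2310 ⟫
             ∷ ⟪ 3120 ⟫ ∷ ⟪ 0321 ⟫ ∷ ⟪ 3021 ⟫ ∷ ⟪ 0231 ⟫ ∷ ⟪ 2031 ⟫ ∷ ⟪ 3201 ⟫ ∷ ⟪ 2301 ⟫ ∷ []) ∷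
  (⟪ 3120 ⟫ , ⟪ 1023 ⟫ ∷ ⟪ 0213 ⟫ ∷ ⟪ 2013 ⟫ ∷ ⟪ 1203 ⟫ ∷ ⟪ 2103 ⟫ ∷ ⟪ 1302 ⟫ ∷ ⟪ 3102 ⟫ ∷ ⟪ 1032 ⟫
             ∷ ⟪ 0132 ⟫ ∷ ⟪ 3012 ⟫ ∷ ⟪ 0312 ⟫ ∷ ⟪ 3210 ⟫ ∷ ⟪ 2310 ⟫ ∷ ⟪ 1230 ⟫ ∷ ⟪ 2130 ⟫
             ∷ ⟪ 1320 ⟫ ∷ ⟪ 3021 ⟫ ∷ ⟪ 0231 ⟫ ∷ ⟪ 2301 ⟫ ∷ ⟪ 3201 ⟫ ∷ ⟪ 2031 ⟫ ∷ ⟪ 0321 ⟫ ∷ []) ∷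
  (⟪ 3201 ⟫ , ⟪ 1023 ⟫ ∷ ⟪ 0213 ⟫ ∷ ⟪ 2013 ⟫ ∷ ⟪ 1203 ⟫ ∷ ⟪ 2103 ⟫ ∷ ⟪ 1302 ⟫ ∷ ⟪ 3102 ⟫ ∷ ⟪ 1032 ⟫
             ∷ ⟪ 0132 ⟫ ∷ ⟪ 3012 ⟫ ∷ ⟪ 0312 ⟫ ∷ ⟪ 3210 ⟫ ∷ ⟪ 2310 ⟫ ∷ ⟪ 3120 ⟫ ∷ ⟪ 1320 ⟫
             ∷ ⟪ 2130 ⟫ ∷ ⟪ 1230 ⟫ ∷ ⟪ 2031 ⟫ ∷ ⟪ 0231 ⟫ ∷ ⟪ 2301 ⟫ ∷ ⟪ 3021 ⟫ ∷ ⟪ 0321 ⟫ ∷ []) ∷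
  (⟪ 3210 ⟫ , ⟪ 1023 ⟫ ∷ ⟪ 0213 ⟫ ∷ ⟪ 2013 ⟫ ∷ ⟪ 1203 ⟫ ∷ ⟪ 2103 ⟫ ∷ ⟪ 1302 ⟫ ∷ ⟪ 3102 ⟫ ∷ ⟪ 1032 ⟫
             ∷ ⟪ 0132 ⟫ ∷ ⟪ 1230 ⟫ ∷ ⟪ 2130 ⟫ ∷ ⟪ 1320 ⟫ ∷ ⟪ 3021 ⟫ ∷ ⟪ 0231 ⟫ ∷ ⟪ 2301 ⟫
             ∷ ⟪ 3201 ⟫ ∷ ⟪ 2031 ⟫ ∷ ⟪ 0321 ⟫ ∷ ⟪ 3120 ⟫ ∷ ⟪ 2310 ⟫ ∷ ⟪ 3012 ⟫ ∷ ⟪ 0312 ⟫ ∷ []) ∷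
  []

abstract
  certificates-valid : All Certificate certificates
  certificates-valid = toWitness {a? = All.all? certificate? certificates} _

  certificates-cover : ∀ t → IsPerm t → t ≡ identity ⊎ t ∈ map proj₁ certificates
  certificates-cover = toWitness {a? = all-Str? λ t →
    IsPerm? t →-dec ((t ≟ˢ identity) ⊎-dec Any.any? (t ≟ˢ_) (map proj₁ certificates))} _

from-identity : ∀ {t} → IsPerm t → t ≢ identity → HamiltonianPath IsPerm identity t
from-identity t! t≢id with certificates-cover _ t!
... | inj₁ t≡id = contradiction t≡id t≢id
... | inj₂ t∈ with ∈-map⁻ proj₁ t∈
... | (_ , mid) , c∈ , refl with All.lookup certificates-valid c∈
... | walk! , linked , perms , covers = record
  { interior = mid ; unique = walk! ; linked = linked
  ; sound = All.lookup perms ; complete = covers _ }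

relabel-identity : ∀ (s : Str 2) → Vec.map (lookup s) identity ≡ s
relabel-identity (_ ∷ _ ∷ _ ∷ _ ∷ []) = refl

HamiltonConnected-S₄ : HamiltonConnected 2
HamiltonConnected-S₄ {s} {t} s! t! s≢t with relabel-onto (IsPerm⇒lookup-injective s!) t!
... | t′ , t′! , refl =
  subst (λ a → HamiltonianPath IsPerm a (Vec.map (lookup s) t′)) (relabel-identity s)
    (relabel-HamiltonianPath (IsPerm⇒lookup-injective s!) (from-identity t′! t′≢identity))
  where
  t′≢identity : t′ ≢ identity
  t′≢identity t′≡id =
    s≢t (trans (sym (relabel-identity s)) (cong (Vec.map (lookup s)) (sym t′≡id)))

-- Leaving a block

Adj-apply : ∀ (μ : Move m) {w} → lastSym (apply μ w) ≢ lastSym w → Adj w (apply μ w)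
Adj-apply μ last≢ = Move⇒Adj μ (λ w≡ → last≢ (cong lastSym (sym w≡))) refl

exit₁ exit₂ : Str (suc m) → Str (suc m)
exit₁ = apply (type-ii (fromℕ _))
exit₂ = apply (type-iii (fromℕ _))

lastSym-exit₁ : ∀ (w : Str (suc m)) → lastSym (exit₁ w) ≡ sym1 w
lastSym-exit₁ w = trans (lookup-apply (type-ii _) w _) (cong (lookup w) (redirect-self (fromℕ _) 0F))

lastSym-exit₂ : ∀ (w : Str (suc m)) → lastSym (exit₂ w) ≡ sym2 w
lastSym-exit₂ w = trans (lookup-apply (type-iii _) w _) (cong (lookup w) (redirect-self (fromℕ _) 1F))

sym1-exit₁ : ∀ (w : Str (suc m)) → sym1 (exit₁ w) ≡ sym2 w
sym1-exit₁ w = lookup-apply (type-ii _) w 0F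

module _ {w : Str m} (w! : IsPerm w) where

  sym1≢sym2 : sym1 w ≢ sym2 w
  sym1≢sym2 = (λ ()) ∘ IsPerm⇒lookup-injective w!

  sym1≢lastSym : sym1 w ≢ lastSym w
  sym1≢lastSym = (λ ()) ∘ IsPerm⇒lookup-injective w!

module _ {w : Str (suc m)} (w! : IsPerm w) where

  sym2≢lastSym : sym2 w ≢ lastSym w
  sym2≢lastSym = (λ ()) ∘ IsPerm⇒lookup-injective w!

  Adj-exit₁ : Adj w (exit₁ w)
  Adj-exit₁ = Adj-apply (type-ii _) (sym1≢lastSym w! ∘ trans (sym (lastSym-exit₁ w)))

  Adj-exit₂ : Adj w (exit₂ w)
  Adj-exit₂ = Adj-apply (type-iii _) (sym2≢lastSym ∘ trans (sym (lastSym-exit₂ w)))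

  exit₁-Block : Block (sym1 w) (exit₁ w)
  exit₁-Block = IsPerm-resp-Adj Adj-exit₁ w! , lastSym-exit₁ w

  exit₂-Block : Block (sym2 w) (exit₂ w)
  exit₂-Block = IsPerm-resp-Adj Adj-exit₂ w! , lastSym-exit₂ w

module _ {n : ℕ} where

  transposeˡ : ∀ (i j : Fin n) → transpose i j i ≡ j
  transposeˡ i j rewrite dec-true (i ≟ i) refl = refl

  transpose-other : ∀ (i j : Fin n) {k} → k ≢ i → k ≢ j → transpose i j k ≡ k
  transpose-other i j {k} k≢i k≢j rewrite dec-false (k ≟ i) k≢i | dec-false (k ≟ j) k≢j = refl

  transpose-inverse′ : ∀ (i j : Fin n) {x y} → transpose i j x ≡ y → x ≡ transpose j i y
  transpose-inverse′ i j {x} eq = trans (sym (transpose-inverse j i {x})) (cong (transpose j i) eq)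

  transpose-injective : ∀ (i j : Fin n) → Injective _≡_ _≡_ (transpose i j)
  transpose-injective i j {_} {l} eq = trans (transpose-inverse′ i j eq) (transpose-inverse j i {l})

-- Three transpositions send the positions 1, 2 and n to the symbols a, b and c.
prescribed : ∀ {a b c : Fin (2+ (suc m))} → a ≢ b → a ≢ c → b ≢ c →
             ∃ λ (w : Str (suc m)) → IsPerm w × sym1 w ≡ a × sym2 w ≡ b × lastSym w ≡ c
prescribed {m} {a} {b} {c} a≢b a≢c b≢c =
    tabulate g
  , lookup-injective⇒IsPerm (λ {p} {q} eq → g-injective
      (trans (sym (lookup∘tabulate g p)) (trans eq (lookup∘tabulate g q))))
  , trans (lookup∘tabulate g 0F) g-first
  , trans (lookup∘tabulate g 1F) g-second
  , trans (lookup∘tabulate g L) g-last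
  where
  open ≡-Reasoning
  L b′ c′ : Fin (2+ (suc m))
  L  = fromℕ _
  b′ = transpose a 0F b
  c′ = transpose b′ 1F (transpose a 0F c)
  t₀ t₁ : Fin (2+ (suc m)) → Fin (2+ (suc m))
  t₀ = transpose 0F a
  t₁ = transpose 1F b′
  g : Fin (2+ (suc m)) → Fin (2+ (suc m))
  g = t₀ ∘ t₁ ∘ transpose L c′
  g-injective : Injective _≡_ _≡_ g
  g-injective = transpose-injective L c′ ∘ transpose-injective 1F b′ ∘ transpose-injective 0F a
  0≢b′ : 0F ≢ b′
  0≢b′ 0≡b′ = a≢b (sym (trans (transpose-inverse′ a 0F (sym 0≡b′)) (transposeˡ 0F a)))
  0≢c′ : 0F ≢ c′
  0≢c′ 0≡c′ = a≢c (sym (begin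
    c            ≡⟨ transpose-inverse′ a 0F (transpose-inverse′ b′ 1F (sym 0≡c′)) ⟩
    t₀ (t₁ 0F)   ≡⟨ cong t₀ (transpose-other 1F b′ (λ ()) 0≢b′) ⟩
    t₀ 0F        ≡⟨ transposeˡ 0F a ⟩
    a            ∎))
  1≢c′ : 1F ≢ c′
  1≢c′ 1≡c′ = b≢c (sym (transpose-injective a 0F
    (trans (transpose-inverse′ b′ 1F (sym 1≡c′)) (transposeˡ 1F b′))))
  g-first : g 0F ≡ a
  g-first = begin
    g 0F         ≡⟨ cong (t₀ ∘ t₁) (transpose-other L c′ (λ ()) 0≢c′) ⟩
    t₀ (t₁ 0F)   ≡⟨ cong t₀ (transpose-other 1F b′ (λ ()) 0≢b′) ⟩
    t₀ 0F        ≡⟨ transposeˡ 0F a ⟩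
    a            ∎
  g-second : g 1F ≡ b
  g-second = begin
    g 1F         ≡⟨ cong (t₀ ∘ t₁) (transpose-other L c′ (λ ()) 1≢c′) ⟩
    t₀ (t₁ 1F)   ≡⟨ cong t₀ (transposeˡ 1F b′) ⟩
    t₀ b′        ≡⟨ transpose-inverse 0F a {b} ⟩
    b            ∎
  g-last : g L ≡ c
  g-last = begin
    g L                          ≡⟨ cong (t₀ ∘ t₁) (transposeˡ L c′) ⟩
    t₀ (t₁ c′)                   ≡⟨ cong t₀ (transpose-inverse 1F b′ {transpose a 0F c}) ⟩
    t₀ (transpose a 0F c)        ≡⟨ transpose-inverse 0F a {c} ⟩
    c                            ∎

missing-symbol : ∀ {n} (xs : List (Fin n)) → length xs < n → ∃ λ y → y ∉ xs
missing-symbol {n} xs |xs|<n with any? (λ y → ¬? (Any.any? (y ≟_) xs))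
... | yes found = found
... | no none   = ⊥-elim (<⇒notInjective |xs|<n index-injective)
  where
  ∈xs : ∀ y → y ∈ xs
  ∈xs y = decidable-stable (Any.any? (y ≟_) xs) (λ y∉ → none (y , y∉))
  index-injective : Injective _≡_ _≡_ (Any.index ∘ ∈xs)
  index-injective {x} {y} eq =
    trans (lookup-index (∈xs x)) (trans (cong (List.lookup xs) eq) (sym (lookup-index (∈xs y))))

-- Walking through blocks

InBlocks : List (Fin (2+ m)) → Pred (Str m) 0ℓ
InBlocks ps w = IsPerm w × lastSym w ∈ ps

Block≐InBlocks : ∀ {p : Fin (2+ m)} → Block p ≐ InBlocks [ p ]
Block≐InBlocks = (λ (w! , w∈p) → w! , here w∈p) , λ { (w! , here w∈p) → w! , w∈p }

Block-∪-InBlocks : ∀ {p : Fin (2+ m)} {ps} → Block p ∪ InBlocks ps ≐ InBlocks (p ∷ ps)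
Block-∪-InBlocks =
    [ (λ (w! , w∈p) → w! , here w∈p) , (λ (w! , w∈ps) → w! , there w∈ps) ]′
  , λ { (w! , here w∈p) → inj₁ (w! , w∈p) ; (w! , there w∈ps) → inj₂ (w! , w∈ps) }

module _ {a : Level} {A : Set a} where

  lastOf : A → List A → A
  lastOf x []       = x
  lastOf _ (y ∷ ys) = lastOf y ys

  lastOf-∷ʳ : ∀ (x : A) xs y → lastOf x (xs ++ [ y ]) ≡ y
  lastOf-∷ʳ x []        y = refl
  lastOf-∷ʳ x (x′ ∷ xs) y = lastOf-∷ʳ x′ xs y

module _ {n : ℕ} {P : Pred (Fin n) 0ℓ} (P? : Decidable P) where

  itinerary : Fin n → Fin n → List (Fin n)
  itinerary a b = a ∷ filter P? (allFin n) ++ [ b ]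

  itinerary-unique : ∀ {a b} → a ≢ b → ¬ P a → ¬ P b → Unique (itinerary a b)
  itinerary-unique a≢b ¬Pa ¬Pb =
      All.++⁺ (All.tabulate λ x∈ a≡x → ¬Pa (subst P (sym a≡x) (∈P x∈))) (a≢b ∷ [])
    ∷ Unique.++⁺ (Unique.filter⁺ P? {xs = allFin n} (Unique.allFin⁺ n)) ([] ∷ [])
                 (λ { (x∈ , here refl) → ¬Pb (∈P x∈) })
    where
    ∈P : ∀ {x} → x ∈ filter P? (allFin n) → P x
    ∈P = proj₂ ∘ ∈-filter⁻ P? {xs = allFin n}

  ∈-itinerary⁻ : ∀ {a b x} → x ∈ itinerary a b → x ≡ a ⊎ P x ⊎ x ≡ b
  ∈-itinerary⁻ (here x≡a) = inj₁ x≡a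
  ∈-itinerary⁻ (there x∈) with ∈-++⁻ (filter P? (allFin n)) x∈
  ... | inj₁ x∈P        = inj₂ (inj₁ (proj₂ (∈-filter⁻ P? {xs = allFin n} x∈P)))
  ... | inj₂ (here x≡b) = inj₂ (inj₂ x≡b)

  ∈-itinerary⁺ : ∀ {a b x} → x ≡ a ⊎ P x ⊎ x ≡ b → x ∈ itinerary a b
  ∈-itinerary⁺         (inj₁ x≡a)        = here x≡a
  ∈-itinerary⁺ {x = x} (inj₂ (inj₁ Px))  = there (∈-++⁺ˡ (∈-filter⁺ P? (∈-allFin x) Px))
  ∈-itinerary⁺         (inj₂ (inj₂ x≡b)) = there (∈-++⁺ʳ (filter P? (allFin n)) (here x≡b))

module _ {n : ℕ} where

  _∉?_ : ∀ (x : Fin n) xs → Dec (x ∉ xs)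
  x ∉? xs = ¬? (Any.any? (x ≟_) xs)

  sweep : Fin n → Fin n → List (Fin n) → List (Fin n)
  sweep a b ys = itinerary (_∉? (a ∷ b ∷ ys)) a b

  ∈-sweep : ∀ {a b x : Fin n} ys → x ∉ ys → x ∈ sweep a b ys
  ∈-sweep {a} {b} {x} ys x∉ys with x ≟ a | x ≟ b
  ... | yes x≡a | _       = here x≡a
  ... | no  _   | yes x≡b = ∈-itinerary⁺ (_∉? (a ∷ b ∷ ys)) (inj₂ (inj₂ x≡b))
  ... | no  x≢a | no  x≢b = ∈-itinerary⁺ (_∉? (a ∷ b ∷ ys)) (inj₂ (inj₁ λ
    { (here x≡a)           → x≢a x≡a
    ; (there (here x≡b))   → x≢b x≡b
    ; (there (there x∈ys)) → x∉ys x∈ys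
    }))

  ∉-sweep : ∀ {a b x : Fin n} {ys} → x ≢ a → x ≢ b → x ∈ ys → x ∉ sweep a b ys
  ∉-sweep {a} {b} {ys = ys} x≢a x≢b x∈ys x∈ with ∈-itinerary⁻ (_∉? (a ∷ b ∷ ys)) x∈
  ... | inj₁ x≡a        = x≢a x≡a
  ... | inj₂ (inj₁ x∉)  = x∉ (there (there x∈ys))
  ... | inj₂ (inj₂ x≡b) = x≢b x≡b

Block-∪-sweep : ∀ {a b c : Fin (2+ m)} → Block a ∪ InBlocks (sweep c b [ a ]) ≐ IsPerm
Block-∪-sweep {a = a} {b} {c} = [ proj₁ , proj₁ ]′ , λ {w} w! → cover w! (lastSym w ≟ a)
  where
  cover : ∀ {w} → IsPerm w → Dec (lastSym w ≡ a) → (Block a ∪ InBlocks (sweep c b [ a ])) w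
  cover w! (yes w∈a) = inj₁ (w! , w∈a)
  cover w! (no  w∉a) = inj₂ (w! , ∈-sweep [ a ] λ { (here w∈a) → w∉a w∈a })

outside-neighbour : ∀ {s : Str (suc m)} → IsPerm s → ∀ b →
                    ∃₂ λ c f → Adj s f × Block c f × c ≢ b × c ≢ lastSym s
outside-neighbour {s = s} s! b with sym1 s ≟ b
... | no  x₁≢b = sym1 s , exit₁ s , Adj-exit₁ s! , exit₁-Block s! , x₁≢b , sym1≢lastSym s!
... | yes x₁≡b = sym2 s , exit₂ s , Adj-exit₂ s! , exit₂-Block s!
               , (λ x₂≡b → sym1≢sym2 s! (trans x₁≡b (sym x₂≡b))) , sym2≢lastSym s!

record Exit (p q : Fin (2+ (suc m))) (f : Str (suc m)) (z : Fin (2+ (suc m))) : Set where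
  field
    {exit entry} : Str (suc m)
    block-path   : HamiltonianPath (Block p) f exit
    exit~entry   : Adj exit entry
    entry∈q      : Block q entry
    entry-fresh  : sym1 entry ≢ z

open Exit

module Traversal {m : ℕ} (2≤m : 2 ≤ m) (hc : HamiltonConnected m) where

  -- The exit vertex gets x₁ = q, so that exit₁ leads into block q, and a fresh x₂, which becomes
  -- x₁ of the entry vertex; the final block is entered away from the endpoint by taking z = its x₁.
  leave : ∀ {p q f} → p ≢ q → Block p f → ∀ z → Exit p q f z
  leave {p} {q} {f} p≢q (f! , f∈p) z
    with missing-symbol (p ∷ q ∷ sym2 f ∷ z ∷ []) (s≤s (s≤s (s≤s 2≤m)))
  ... | y , y∉ with prescribed {a = q} {b = y} {c = p} (λ q≡y → y∉ (there (here (sym q≡y))))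
                                                      (p≢q ∘ sym) (λ y≡p → y∉ (here y≡p))
  ... | e , e! , e-sym1 , e-sym2 , e∈p = record
    { block-path  = block-HamiltonianPath hc (f! , f∈p) (e! , e∈p) f≢e
    ; exit~entry  = Adj-exit₁ e!
    ; entry∈q     = subst (λ c → Block c (exit₁ e)) e-sym1 (exit₁-Block e!)
    ; entry-fresh = λ x₁≡z → y∉ (there (there (there (here
                      (trans (sym (trans (sym1-exit₁ e) e-sym2)) x₁≡z)))))
    }
    where
    f≢e : f ≢ e
    f≢e f≡e = y∉ (there (there (here (trans (sym e-sym2) (cong sym2 (sym f≡e))))))

  traverse : ∀ p ps {f e} → Unique (p ∷ ps) → Block p f → Block (lastOf p ps) e → f ≢ e →
             HamiltonianPath (InBlocks (p ∷ ps)) f e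
  traverse p []       _ f∈p e∈p f≢e =
    HamiltonianPath-resp Block≐InBlocks (block-HamiltonianPath hc f∈p e∈p f≢e)
  traverse p (q ∷ ps) {f} {e} (p∉ ∷ qps!) f∈p e∈ _ =
    HamiltonianPath-resp Block-∪-InBlocks
      (join (block-path x) (exit~entry x)
            (traverse q ps qps! (entry∈q x) e∈ (entry-fresh x ∘ cong sym1)) disjoint)
    where
    x : Exit p q f (sym1 e)
    x = leave (All.head p∉) f∈p (sym1 e)
    disjoint : Block p ⊥ InBlocks (q ∷ ps)
    disjoint ((_ , refl) , (_ , w∈)) = All.lookup p∉ w∈ refl

  through : ∀ {P : Pred (Fin (2+ (suc m))) 0ℓ} (P? : Decidable P) {a b f e} →
            a ≢ b → ¬ P a → ¬ P b → Block a f → Block b e →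
            HamiltonianPath (InBlocks (itinerary P? a b)) f e
  through P? {a} {b} {e = e} a≢b ¬Pa ¬Pb f∈a@(_ , f-last) e∈b@(_ , e-last) =
    traverse a (filter P? (allFin _) ++ [ b ]) (itinerary-unique P? a≢b ¬Pa ¬Pb) f∈a
      (subst (λ c → Block c e) (sym (lastOf-∷ʳ a (filter P? (allFin _)) b)) e∈b)
      (λ f≡e → a≢b (trans (sym f-last) (trans (cong lastSym f≡e) e-last)))

  through-sweep : ∀ {a b f e} ys → a ≢ b → Block a f → Block b e →
                  HamiltonianPath (InBlocks (sweep a b ys)) f e
  through-sweep {a} {b} ys a≢b =
    through (_∉? (a ∷ b ∷ ys)) a≢b (λ a∉ → a∉ (here refl)) (λ b∉ → b∉ (there (here refl)))

  between-blocks : ∀ {s t : Str (suc m)} → IsPerm s → IsPerm t → lastSym s ≢ lastSym t →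
                   HamiltonianPath IsPerm s t
  between-blocks s! t! a≢b =
    HamiltonianPath-resp (proj₁ , λ w! → w! , ∈-sweep [] (λ ()))
      (through-sweep [] a≢b (s! , refl) (t! , refl))

  -- Detour from s through all other blocks, re-entering block a at the successor of s.
  within-block : ∀ {s t : Str (suc m)} → IsPerm s → IsPerm t → s ≢ t → lastSym s ≡ lastSym t →
                 HamiltonianPath IsPerm s t
  within-block {s} {t} s! t! s≢t a≡b = detour (outside-neighbour s! b′)
    where
    a : Fin (2+ (suc m))
    a = lastSym s
    h : HamiltonianPath (Block a) s t
    h = block-HamiltonianPath hc (s! , refl) (t! , sym a≡b) s≢t
    s′! : IsPerm (successor h)
    s′! = proj₁ (successor-∈ h)
    b′ : Fin (2+ (suc m))
    b′ = sym1 (successor h)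
    b′≢a : b′ ≢ a
    b′≢a b′≡a = sym1≢lastSym s′! (trans b′≡a (sym (proj₂ (successor-∈ h))))
    detour : (∃₂ λ c f → Adj s f × Block c f × c ≢ b′ × c ≢ a) → HamiltonianPath IsPerm s t
    detour (c , f , s~f , f∈c , c≢b′ , c≢a) =
      HamiltonianPath-resp Block-∪-sweep
        (insert h s~f (through-sweep [ a ] c≢b′ f∈c (exit₁-Block s′!)) (Adj-sym (Adj-exit₁ s′!))
          λ ((_ , w∈a) , (_ , w∈)) → ∉-sweep (c≢a ∘ sym) (b′≢a ∘ sym) (here refl)
                                              (subst (_∈ sweep c b′ [ a ]) w∈a w∈))

  HamiltonConnected-suc : HamiltonConnected (suc m)
  HamiltonConnected-suc {s} {t} s! t! s≢t with lastSym s ≟ lastSym t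
  ... | no  a≢b = between-blocks s! t! a≢b
  ... | yes a≡b = within-block s! t! s≢t a≡b

HamiltonConnected-2+ : ∀ k → HamiltonConnected (2+ k)
HamiltonConnected-2+ zero    = HamiltonConnected-S₄
HamiltonConnected-2+ (suc k) = Traversal.HamiltonConnected-suc (s≤s (s≤s z≤n)) (HamiltonConnected-2+ k)

HamiltonConnected-≥2 : 2 ≤ m → HamiltonConnected m
HamiltonConnected-≥2 (s≤s (s≤s _)) = HamiltonConnected-2+ _

-- The cycle through u v

close : ∀ {m} {Q : Pred (Str m) 0ℓ} {u v f e} → HamiltonianPath Q f e → Q ⊆ IsPerm →
        IsPerm u → IsPerm v → ¬ Q u → ¬ Q v → Adj u v → Adj v f → Adj e u →
        Σ (Cycle m) λ C → (∀ w → (w ∈V C) ⇔ (Q w ⊎ w ≡ u ⊎ w ≡ v)) × ((u , v) ∈E C)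
close {m} {Q} {u} {v} {f} {e} h Q⊆IsPerm u! v! u∉Q v∉Q u~v v~f e~u =
  C , (λ w → mk⇔ to from) , inj₁ ([] , walk f (interior h) e ++ [ u ] , refl)
  where
  C : Cycle m
  C = cycle u (v ∷ walk f (interior h) e) (s≤s (s≤s (s≤s z≤n)))
        (u! ∷ v! ∷ All.tabulate (Q⊆IsPerm ∘ sound h))
        (  (proj₁ u~v ∷ All.tabulate (λ w∈ u≡w → u∉Q (subst Q (sym u≡w) (sound h w∈))))
         ∷ All.tabulate (λ w∈ v≡w → v∉Q (subst Q (sym v≡w) (sound h w∈)))
         ∷ unique h)
        (u~v ∷ v~f ∷ Linked.++⁺ (linked h)
           (subst (λ l → Connected Adj l (just u)) (sym (last-walk f (interior h) e)) (just e~u)) [-])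
  to : ∀ {w} → w ∈V C → Q w ⊎ w ≡ u ⊎ w ≡ v
  to (here w≡u)         = inj₂ (inj₁ w≡u)
  to (there (here w≡v)) = inj₂ (inj₂ w≡v)
  to (there (there w∈)) = inj₁ (sound h w∈)
  from : ∀ {w} → Q w ⊎ w ≡ u ⊎ w ≡ v → w ∈V C
  from (inj₁ q)          = there (there (complete h q))
  from (inj₂ (inj₁ w≡u)) = here w≡u
  from (inj₂ (inj₂ w≡v)) = there (here w≡v)

sym2-or-sym1 : ∀ {m} {u v : Str m} → Adj u v → sym2 v ≡ sym1 u ⊎ sym1 v ≡ sym2 u
sym2-or-sym1 {u = u} u~v with Adj⇒Move u~v
... | type-i     , refl = inj₁ (lookup-apply type-i u 1F)
... | type-ii k  , refl = inj₂ (lookup-apply (type-ii k) u 0F)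
... | type-iii k , refl = inj₁ (lookup-apply (type-iii k) u 1F)

record Exits {m} (u v : Str (suc m)) : Set where
  field
    c₁ c₂ : Fin (2+ (suc m))
    {f e} : Str (suc m)
    v~f   : Adj v f
    e~u   : Adj e u
    f∈c₁  : Block c₁ f
    e∈c₂  : Block c₂ e
    c₁≢c₂ : c₁ ≢ c₂
    ends  : ∀ {x} → (x ≡ c₁ ⊎ x ≡ c₂) ⇔ (x ≡ sym1 u ⊎ x ≡ sym2 u)

exits : ∀ {m} {u v : Str (suc m)} → IsPerm u → Adj u v → Exits u v
exits {u = u} {v} u! u~v with sym2-or-sym1 u~v
... | inj₁ x₂v≡x₁u = record
  { c₁ = sym1 u ; c₂ = sym2 u
  ; v~f = Adj-exit₂ v! ; e~u = Adj-sym (Adj-exit₂ u!)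
  ; f∈c₁ = subst (λ c → Block c (exit₂ v)) x₂v≡x₁u (exit₂-Block v!)
  ; e∈c₂ = exit₂-Block u!
  ; c₁≢c₂ = sym1≢sym2 u! ; ends = ⇔.refl
  }
  where
  v! : IsPerm v
  v! = IsPerm-resp-Adj u~v u!
... | inj₂ x₁v≡x₂u = record
  { c₁ = sym2 u ; c₂ = sym1 u
  ; v~f = Adj-exit₁ v! ; e~u = Adj-sym (Adj-exit₁ u!)
  ; f∈c₁ = subst (λ c → Block c (exit₁ v)) x₁v≡x₂u (exit₁-Block v!)
  ; e∈c₂ = exit₁-Block u!
  ; c₁≢c₂ = sym1≢sym2 u! ∘ sym ; ends = mk⇔ swap swap
  }
  where
  v! : IsPerm v
  v! = IsPerm-resp-Adj u~v u!

module Route {m : ℕ} {u v : Str (suc m)} (u! : IsPerm u) (E : Exits u v) (T : Subset (2+ (suc m)))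
             (T-avoids : ∀ t → t ∈ˢ T → ¬ (t ≡ sym1 u) × ¬ (t ≡ sym2 u) × ¬ (t ≡ lastSym u)) where
  open Exits E

  route : List (Fin (2+ (suc m)))
  route = itinerary (_∈ˢ? T) c₁ c₂

  T∌ends : ∀ {x} → x ≡ c₁ ⊎ x ≡ c₂ → ¬ x ∈ˢ T
  T∌ends x-end x∈T with Equivalence.to ends x-end | T-avoids _ x∈T
  ... | inj₁ x≡x₁ | x≢x₁ , _     = x≢x₁ x≡x₁
  ... | inj₂ x≡x₂ | _ , x≢x₂ , _ = x≢x₂ x≡x₂

  ∈-route : ∀ {x} → x ∈ route ⇔ (x ∈ˢ T ⊎ x ≡ sym1 u ⊎ x ≡ sym2 u)
  ∈-route = mk⇔ (to ∘ ∈-itinerary⁻ (_∈ˢ? T)) (∈-itinerary⁺ (_∈ˢ? T) ∘ from)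
    where
    to : ∀ {x} → x ≡ c₁ ⊎ x ∈ˢ T ⊎ x ≡ c₂ → x ∈ˢ T ⊎ x ≡ sym1 u ⊎ x ≡ sym2 u
    to (inj₁ x≡c₁)        = inj₂ (Equivalence.to ends (inj₁ x≡c₁))
    to (inj₂ (inj₁ x∈T))  = inj₁ x∈T
    to (inj₂ (inj₂ x≡c₂)) = inj₂ (Equivalence.to ends (inj₂ x≡c₂))
    from : ∀ {x} → x ∈ˢ T ⊎ x ≡ sym1 u ⊎ x ≡ sym2 u → x ≡ c₁ ⊎ x ∈ˢ T ⊎ x ≡ c₂
    from (inj₁ x∈T)   = inj₂ (inj₁ x∈T)
    from (inj₂ x-end) = [ inj₁ , inj₂ ∘ inj₂ ]′ (Equivalence.from ends x-end)

  lastSym∉route : ¬ lastSym u ∈ route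
  lastSym∉route j∈route with Equivalence.to ∈-route j∈route
  ... | inj₁ j∈T         = proj₂ (proj₂ (T-avoids _ j∈T)) refl
  ... | inj₂ (inj₁ j≡x₁) = sym1≢lastSym u! (sym j≡x₁)
  ... | inj₂ (inj₂ j≡x₂) = sym2≢lastSym u! (sym j≡x₂)

  Target : Pred (Str (suc m)) 0ℓ
  Target w = IsPerm w × (lastSym w ∈ˢ T ⊎ lastSym w ≡ sym1 u ⊎ lastSym w ≡ sym2 u ⊎ w ≡ u ⊎ w ≡ v)

  vertex-set : IsPerm v → ∀ w → (InBlocks route w ⊎ w ≡ u ⊎ w ≡ v) ⇔ Target w
  vertex-set v! w = mk⇔ to from
    where
    to : InBlocks route w ⊎ w ≡ u ⊎ w ≡ v → Target w
    to (inj₁ (w! , w∈))   = w! , map₂ (map₂ inj₁) (Equivalence.to ∈-route w∈)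
    to (inj₂ (inj₁ refl)) = u! , inj₂ (inj₂ (inj₂ (inj₁ refl)))
    to (inj₂ (inj₂ refl)) = v! , inj₂ (inj₂ (inj₂ (inj₂ refl)))
    from : Target w → InBlocks route w ⊎ w ≡ u ⊎ w ≡ v
    from (w! , inj₁ w∈T)                      = inj₁ (w! , Equivalence.from ∈-route (inj₁ w∈T))
    from (w! , inj₂ (inj₁ w≡x₁))              = inj₁ (w! , Equivalence.from ∈-route (inj₂ (inj₁ w≡x₁)))
    from (w! , inj₂ (inj₂ (inj₁ w≡x₂)))       = inj₁ (w! , Equivalence.from ∈-route (inj₂ (inj₂ w≡x₂)))
    from (_  , inj₂ (inj₂ (inj₂ (inj₁ w≡u)))) = inj₂ (inj₁ w≡u)
    from (_  , inj₂ (inj₂ (inj₂ (inj₂ w≡v)))) = inj₂ (inj₂ w≡v)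

lemma2p7 : (m : ℕ) → 3 ≤ m → (j : Fin (suc (suc m))) → (u v : Str m) →
    IsPerm u → IsPerm v → Adj u v → lastSym u ≡ j → lastSym v ≡ j →
    (T : Subset (suc (suc m))) →
    (∀ t → t ∈ˢ T → ¬ (t ≡ sym1 u) × ¬ (t ≡ sym2 u) × ¬ (t ≡ j)) →
    Σ (Cycle m) λ C →
      (∀ w → (w ∈V C) ⇔ (IsPerm w ×
         (lastSym w ∈ˢ T ⊎ lastSym w ≡ sym1 u ⊎ lastSym w ≡ sym2 u ⊎ w ≡ u ⊎ w ≡ v)))
      × ((u , v) ∈E C)
lemma2p7 (suc m) (s≤s 2≤m) j u v u! v! u~v refl v∈j T T-avoids =
  let C , spans , uv∈C = close tour proj₁ u! v! (lastSym∉route ∘ proj₂)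
                               (lastSym∉route ∘ subst (_∈ route) v∈j ∘ proj₂) u~v v~f e~u
  in C , (λ w → ⇔.trans (spans w) (vertex-set v! w)) , uv∈C
  where
  E : Exits u v
  E = exits u! u~v
  open Exits E
  open Route u! E T T-avoids
  open Traversal 2≤m (HamiltonConnected-≥2 2≤m)
  tour : HamiltonianPath (InBlocks route) f e
  tour = through (_∈ˢ? T) c₁≢c₂ (T∌ends (inj₁ refl)) (T∌ends (inj₂ refl)) f∈c₁ e∈c₂
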